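{- Let $d\ge 2$ and, for $k\ge 1$, let $N(d,k)$ denote the number of vertices of the $d$-Fibonacci digraph $F(d,k)$. Set $N(d,i)=1$ for $i=2-d,\ldots,-1,0$. Then $N(d,1)=d$ and, for every $k\ge 1$, $$N(d,k+1)=\sum_{i=k-d+1}^{k} N(d,i).$$ That is, the numbers $N(d,k)$ satisfy the same linear recurrence as the $d$-step Fibonacci numbers $F^{(d)}_k=\sum_{i=1}^d F^{(d)}_{k-i}$.
   Context: For integers $d\ge 2$, $k\ge 1$, the $d$-Fibonacci digraph $F(d,k)$ has as vertices all words $x_1x_2\ldots x_k$ with $x_i\in\{0,1,\ldots,d-1\}$ such that for each $i=1,\ldots,k-1$: if $x_i\neq 0$ then $x_{i+1}\equiv x_i+1 \pmod d$ (if $x_i=0$, $x_{i+1}$ is arbitrary). There is an arc from $x_1\ldots x_k$ to $x_2\ldots x_kx_{k+1}$ whenever $x_1\ldots x_{k+1}$ satisfies the same condition. -}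

module Defs where

open import Data.Nat using (ℕ; zero; suc; _+_; _≡ᵇ_; NonZero)
open import Data.Nat.DivMod using (_%_)
open import Data.Bool using (Bool; true; false; _∧_; _∨_)
open import Data.Fin using (Fin; toℕ)
open import Data.Vec using (Vec; []; _∷_)
open import Data.List using (List; concatMap; map; length; filterᵇ; allFin)
  renaming (_∷_ to _∷ₗ_; [] to []ₗ)
open import Data.Integer using (ℤ; +_; -[1+_])

allWords : (d k : ℕ) → List (Vec (Fin d) k)
allWords d zero = [] ∷ₗ []ₗ
allWords d (suc k) = concatMap (λ x → map (x ∷_) (allWords d k)) (allFin d)

stepOK : (d : ℕ) .{{_ : NonZero d}} → Fin d → Fin d → Bool
stepOK d x y = (toℕ x ≡ᵇ 0) ∨ (toℕ y ≡ᵇ ((toℕ x + 1) % d))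

-- A word is a vertex of F(d,k) iff every consecutive pair satisfies stepOK.
validWord : (d : ℕ) .{{_ : NonZero d}} → {k : ℕ} → Vec (Fin d) k → Bool
validWord d [] = true
validWord d (x ∷ []) = true
validWord d (x ∷ y ∷ w) = stepOK d x y ∧ validWord d (y ∷ w)

N : (d : ℕ) .{{_ : NonZero d}} → ℕ → ℕ
N d k = length (filterᵇ (validWord d) (allWords d k))

-- Extension to integer indices: Nℤ d (+ k) = N(d,k) for k ≥ 1, and
-- Nℤ d i = 1 for i ≤ 0 (the statement only uses i = 2-d,…,0 there).
Nℤ : (d : ℕ) .{{_ : NonZero d}} → ℤ → ℕ
Nℤ d (+ zero) = 1
Nℤ d (+ suc k) = N d (suc k)
Nℤ d -[1+ _ ] = 1

sumBelow : ℕ → (ℕ → ℕ) → ℕ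
sumBelow zero f = 0
sumBelow (suc n) f = sumBelow n f + f n

module Submission where

-- Write d = n + 1 and let  start k a  be the number of vertices
-- of F(d,k+1) whose first letter is a.  Splitting the words by their first
-- letter gives  N(d,k+1) = Σ_a start k a,  and  start k 0 = N(d,k)  because
-- a leading 0 puts no constraint on the rest of the word.  A non-zero letter
-- a has exactly one admissible successor, a+1 mod d, so a word starting with
-- a is forced through a, a+1, …, d-1, 0 and is free afterwards; hence
--   start k a = N(d, k - (d - a))   for a = 1, …, d-1,
-- where N(d,i) = 1 for i ≤ 0 accounts for words too short to reach the 0.
-- Summing over a and reindexing by j = d - a gives the recurrence; the case
-- k = 0 gives N(d,1) = d.

open import Defs
open import Data.Nat using (ℕ; zero; suc; _+_; _∸_; _≤_; _<_; _≡ᵇ_; s≤s; NonZero)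
open import Data.Nat.Properties
  using (+-comm; +-assoc; +-suc; +-identityʳ; m≤n+m; m<n⇒m<1+n; n<1+n; m∸n+n≡m; m∸[m∸n]≡n; <⇒≤; <-irrefl)
open import Data.Nat.DivMod using (_%_; n%n≡0; m<n⇒m%n≡m)
open import Data.Nat.ListAction using (sum)
open import Data.Integer using (+_; _-_)
import Data.Integer.Properties as ℤ
open import Data.Bool using (Bool; true; false; _∧_; if_then_else_)
open import Data.Fin using (Fin; toℕ; fromℕ<) renaming (zero to fzero; suc to fsuc)
open import Data.Fin.Properties using (toℕ<n; toℕ-fromℕ<)
open import Data.Vec using (_∷_)
open import Data.List using (List; concatMap; map; length; filterᵇ; allFin; _++_)
  renaming (_∷_ to _∷ₗ_; [] to []ₗ)
open import Data.List.Properties using (map-tabulate)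
open import Data.Product using (_×_; _,_)
open import Data.Empty using (⊥-elim)
open import Relation.Binary.PropositionalEquality using (_≡_; refl; sym; trans; cong; cong₂; subst; module ≡-Reasoning)
open ≡-Reasoning

count : {A : Set} → (A → Bool) → List A → ℕ
count p xs = length (filterᵇ p xs)

count-++ : {A : Set} (p : A → Bool) (xs ys : List A) →
  count p (xs ++ ys) ≡ count p xs + count p ys
count-++ p []ₗ ys = refl
count-++ p (x ∷ₗ xs) ys with p x
... | true = cong suc (count-++ p xs ys)
... | false = count-++ p xs ys

count-map : {A B : Set} (p : B → Bool) (g : A → B) (xs : List A) →
  count p (map g xs) ≡ count (λ x → p (g x)) xs
count-map p g []ₗ = refl
count-map p g (x ∷ₗ xs) with p (g x)
... | true = cong suc (count-map p g xs)
... | false = count-map p g xs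

sum-cong : {A : Set} (f g : A → ℕ) (xs : List A) →
  (∀ x → f x ≡ g x) → sum (map f xs) ≡ sum (map g xs)
sum-cong f g []ₗ f≗g = refl
sum-cong f g (x ∷ₗ xs) f≗g = cong₂ _+_ (f≗g x) (sum-cong f g xs f≗g)

count-concatMap : {A B : Set} (p : B → Bool) (f : A → List B) (xs : List A) →
  count p (concatMap f xs) ≡ sum (map (λ x → count p (f x)) xs)
count-concatMap p f []ₗ = refl
count-concatMap p f (x ∷ₗ xs) =
  trans (count-++ p (f x) (concatMap f xs)) (cong₂ _+_ refl (count-concatMap p f xs))

count-blocks : {A B C : Set} (p : C → Bool) (g : A → B → C) (xs : List A) (ys : List B) →
  count p (concatMap (λ x → map (g x) ys) xs) ≡ sum (map (λ x → count (λ y → p (g x y)) ys) xs)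
count-blocks p g xs ys =
  trans (count-concatMap p _ xs) (sum-cong _ _ xs (λ x → count-map p (g x) ys))

count-guard : {A : Set} (c : Bool) (q : A → Bool) (xs : List A) →
  count (λ x → c ∧ q x) xs ≡ (if c then count q xs else 0)
count-guard true q xs = refl
count-guard false q []ₗ = refl
count-guard false q (x ∷ₗ xs) = count-guard false q xs

sum-allFin-suc : (m : ℕ) (h : Fin (suc m) → ℕ) →
  sum (map h (allFin (suc m))) ≡ h fzero + sum (map (λ b → h (fsuc b)) (allFin m))
sum-allFin-suc m h = cong (λ l → h fzero + sum l)
  (trans (map-tabulate fsuc h) (sym (map-tabulate (λ b → b) (λ b → h (fsuc b)))))

sum-indicator : (m : ℕ) (h : Fin m → ℕ) (c : ℕ) (b₀ : Fin m) → toℕ b₀ ≡ c →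
  sum (map (λ b → if toℕ b ≡ᵇ c then h b else 0) (allFin m)) ≡ h b₀
sum-indicator (suc m) h .0 fzero refl = begin
  sum (map (λ b → if toℕ b ≡ᵇ 0 then h b else 0) (allFin (suc m)))
    ≡⟨ sum-allFin-suc m _ ⟩
  h fzero + sum (map (λ _ → 0) (allFin m))
    ≡⟨ cong₂ _+_ refl (sum-zero (allFin m)) ⟩
  h fzero + 0
    ≡⟨ +-identityʳ (h fzero) ⟩
  h fzero ∎
  where
    sum-zero : {A : Set} (xs : List A) → sum (map (λ _ → 0) xs) ≡ 0
    sum-zero []ₗ = refl
    sum-zero (_ ∷ₗ xs) = sum-zero xs
sum-indicator (suc m) h .(suc (toℕ b₀)) (fsuc b₀) refl =
  trans (sum-allFin-suc m (λ b → if toℕ b ≡ᵇ suc (toℕ b₀) then h b else 0))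
        (sum-indicator m (λ b → h (fsuc b)) (toℕ b₀) b₀ refl)

sumBelow-cong : (n : ℕ) (f g : ℕ → ℕ) → (∀ i → i < n → f i ≡ g i) → sumBelow n f ≡ sumBelow n g
sumBelow-cong zero f g f≗g = refl
sumBelow-cong (suc n) f g f≗g =
  cong₂ _+_ (sumBelow-cong n f g (λ i i<n → f≗g i (m<n⇒m<1+n i<n))) (f≗g n (n<1+n n))

sumBelow-suc : (n : ℕ) (f : ℕ → ℕ) → sumBelow (suc n) f ≡ f 0 + sumBelow n (λ i → f (suc i))
sumBelow-suc zero f = +-comm 0 (f 0)
sumBelow-suc (suc n) f = trans (cong (_+ f (suc n)) (sumBelow-suc n f)) (+-assoc (f 0) _ _)

sumBelow-reverse : (n : ℕ) (f : ℕ → ℕ) → sumBelow n f ≡ sumBelow n (λ i → f (n ∸ suc i))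
sumBelow-reverse zero f = refl
sumBelow-reverse (suc n) f = sym (begin
  sumBelow (suc n) (λ i → f (suc n ∸ suc i))
    ≡⟨ sumBelow-suc n _ ⟩
  f n + sumBelow n (λ i → f (n ∸ suc i))
    ≡⟨ cong₂ _+_ refl (sym (sumBelow-reverse n f)) ⟩
  f n + sumBelow n f
    ≡⟨ +-comm (f n) _ ⟩
  sumBelow (suc n) f ∎)

sumBelow-one : (n : ℕ) → sumBelow n (λ _ → 1) ≡ n
sumBelow-one zero = refl
sumBelow-one (suc n) = trans (cong (_+ 1) (sumBelow-one n)) (+-comm n 1)

sum-allFin-toℕ : (n : ℕ) (g : ℕ → ℕ) → sum (map (λ b → g (toℕ b)) (allFin n)) ≡ sumBelow n g
sum-allFin-toℕ zero g = refl
sum-allFin-toℕ (suc n) g = begin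
  sum (map (λ b → g (toℕ b)) (allFin (suc n)))
    ≡⟨ sum-allFin-suc n _ ⟩
  g 0 + sum (map (λ b → g (suc (toℕ b))) (allFin n))
    ≡⟨ cong₂ _+_ refl (sum-allFin-toℕ n (λ i → g (suc i))) ⟩
  g 0 + sumBelow n (λ i → g (suc i))
    ≡⟨ sym (sumBelow-suc n g) ⟩
  sumBelow (suc n) g ∎

-- Throughout, the alphabet size is d = n + 1, and the letters 1, …, d-1 are
-- written  fsuc a  with  a : Fin n.
module Vertices (n : ℕ) where

  d : ℕ
  d = suc n

  Nback : ℕ → ℕ → ℕ
  Nback k j = Nℤ d (+ k - + j)

  Nback-zero : (k : ℕ) → Nback k 0 ≡ N d k
  Nback-zero zero = refl
  Nback-zero (suc k) = cong (Nℤ d) (ℤ.+-identityʳ (+ suc k))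

  Nback-suc : (k j : ℕ) → Nback (suc k) (suc j) ≡ Nback k j
  Nback-suc k j = cong (Nℤ d) (trans (ℤ.[1+m]⊖[1+n]≡m⊖n k j) (sym (ℤ.m-n≡m⊖n k j)))

  start : ℕ → Fin d → ℕ
  start k a = count (λ w → validWord d (a ∷ w)) (allWords d k)

  N-suc : (k : ℕ) → N d (suc k) ≡ sum (map (start k) (allFin d))
  N-suc k = count-blocks (validWord d) _∷_ (allFin d) (allWords d k)

  start-suc : (k : ℕ) (a : Fin d) →
    start (suc k) a ≡ sum (map (λ b → if stepOK d a b then start k b else 0) (allFin d))
  start-suc k a =
    trans (count-blocks (λ w → validWord d (a ∷ w)) _∷_ (allFin d) (allWords d k))
          (sum-cong _ _ (allFin d)
            (λ b → count-guard (stepOK d a b) (λ w → validWord d (b ∷ w)) (allWords d k)))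

  -- After a 0 any letter may follow, so the rest of the word is an arbitrary vertex.
  start-zero : (k : ℕ) → start k fzero ≡ N d k
  start-zero zero = refl
  start-zero (suc k) = trans (start-suc k fzero) (sym (N-suc k))

  -- A non-zero letter has the single successor b = letter + 1 mod d.
  start-forced : (k : ℕ) (a : Fin n) (b : Fin d) → toℕ b ≡ (toℕ (fsuc a) + 1) % d →
    start (suc k) (fsuc a) ≡ start k b
  start-forced k a b b-next =
    trans (start-suc k (fsuc a)) (sum-indicator d (start k) _ b b-next)

  next-of-last : (a : Fin n) → suc (toℕ a) ≡ n → toℕ (fzero {n}) ≡ (toℕ (fsuc a) + 1) % d
  next-of-last a a-last = sym (begin
    suc (toℕ a + 1) % d ≡⟨ cong (λ m → suc m % d) (trans (+-comm (toℕ a) 1) a-last) ⟩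
    d % d               ≡⟨ n%n≡0 d ⟩
    0                   ∎)

  next-of-inner : (a : Fin n) (a+1<n : suc (toℕ a) < n) →
    toℕ (fsuc (fromℕ< a+1<n)) ≡ (toℕ (fsuc a) + 1) % d
  next-of-inner a a+1<n = begin
    suc (toℕ (fromℕ< a+1<n)) ≡⟨ cong suc (toℕ-fromℕ< a+1<n) ⟩
    suc (suc (toℕ a))        ≡⟨ sym (m<n⇒m%n≡m (s≤s a+1<n)) ⟩
    suc (suc (toℕ a)) % d    ≡⟨ cong (λ m → suc m % d) (+-comm 1 (toℕ a)) ⟩
    suc (toℕ a + 1) % d      ∎

  -- A word starting with the non-zero letter d - g is forced through the g
  -- letters d-g, …, d-1 and then reaches 0, after which it is free.
  start-nonzero : (k g : ℕ) (a : Fin n) → g + toℕ a ≡ n → start k (fsuc a) ≡ Nback k g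
  start-nonzero k zero a a≡n = ⊥-elim (<-irrefl a≡n (toℕ<n a))
  -- A single letter is always a vertex, and N(d, -g) = 1.
  start-nonzero zero (suc g) a _ = refl
  start-nonzero (suc k) (suc zero) a a-last = begin
    start (suc k) (fsuc a) ≡⟨ start-forced k a fzero (next-of-last a a-last) ⟩
    start k fzero          ≡⟨ start-zero k ⟩
    N d k                  ≡⟨ sym (Nback-zero k) ⟩
    Nback k 0              ≡⟨ sym (Nback-suc k 0) ⟩
    Nback (suc k) 1        ∎
  start-nonzero (suc k) (suc (suc g)) a gap = begin
    start (suc k) (fsuc a)          ≡⟨ start-forced k a (fsuc b) (next-of-inner a a+1<n) ⟩
    start k (fsuc b)                ≡⟨ start-nonzero k (suc g) b gap′ ⟩
    Nback k (suc g)                 ≡⟨ sym (Nback-suc k (suc g)) ⟩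
    Nback (suc k) (suc (suc g))     ∎
    where
      a+1<n : suc (toℕ a) < n
      a+1<n = subst (suc (toℕ a) <_) gap (s≤s (s≤s (m≤n+m (toℕ a) g)))
      b : Fin n
      b = fromℕ< a+1<n
      gap′ : suc g + toℕ b ≡ n
      gap′ = trans (cong (λ t → suc (g + t)) (toℕ-fromℕ< a+1<n))
                   (trans (cong suc (+-suc g (toℕ a))) gap)

  recurrence : (k : ℕ) → N d (suc k) ≡ sumBelow d (Nback k)
  recurrence k = begin
    N d (suc k)
      ≡⟨ N-suc k ⟩
    sum (map (start k) (allFin d))
      ≡⟨ sum-allFin-suc n (start k) ⟩
    start k fzero + sum (map (λ a → start k (fsuc a)) (allFin n))
      ≡⟨ cong₂ _+_ (trans (start-zero k) (sym (Nback-zero k)))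
                   (trans (sum-cong _ _ (allFin n) start-by-gap)
                          (sum-allFin-toℕ n (λ i → Nback k (n ∸ i)))) ⟩
    Nback k 0 + sumBelow n (λ i → Nback k (n ∸ i))
      ≡⟨ cong₂ _+_ refl (trans (sumBelow-reverse n _) (sumBelow-cong n _ _
           (λ i i<n → cong (Nback k) (m∸[m∸n]≡n i<n)))) ⟩
    Nback k 0 + sumBelow n (λ i → Nback k (suc i))
      ≡⟨ sym (sumBelow-suc n (Nback k)) ⟩
    sumBelow d (Nback k) ∎
    where
      start-by-gap : (a : Fin n) → start k (fsuc a) ≡ Nback k (n ∸ toℕ a)
      start-by-gap a = start-nonzero k (n ∸ toℕ a) a (m∸n+n≡m (<⇒≤ (toℕ<n a)))

  -- Every word of length 1 is a vertex.
  N-one : N d 1 ≡ d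
  N-one = trans (N-suc 0) (trans (sum-allFin-toℕ d (λ _ → 1)) (sumBelow-one d))

proposition2p3 : (d : ℕ) → 2 ≤ d → .{{_ : NonZero d}} →
    (N d 1 ≡ d) ×
    ((k : ℕ) → 1 ≤ k → N d (suc k) ≡ sumBelow d (λ j → Nℤ d (+ k - + j)))
proposition2p3 (suc n) _ = N-one , λ k _ → recurrence k
  where open Vertices n
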